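{- Let $r>p\ge1$, $t\ge p$ and $k\ge1$ be integers. Then there is an integer $N(r,p,t,k)>0$ such that for every $n\ge N(r,p,t,k)$, every orientation $D$ of the complete $r$-uniform hypergraph $H(n,r)$ has a $t$-set $B\subseteq V(H(n,r))$ all of whose $p$-subsets $S$ satisfy $d_i(S)\ge k$ for all $1\le i\le\binom rp$.
   Context: An orientation assigns to each edge a linear ordering of its $r$ vertices (positions $1,\dots,r$). Let $P_1,\dots,P_{\binom rp}$ be the $p$-subsets of $\{1,\dots,r\}$; for a $p$-set $S$, $d_i(S)$ is the number of edges $E\supseteq S$ in which $S$ occupies exactly the positions $P_i$. -}

module Defs where

open import Data.Nat using (ℕ; zero; suc; _≟_)
open import Data.Fin using (Fin)
open import Data.Fin.Subset using (Subset; _∈_; _⊆_; ∣_∣; inside; outside)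
open import Data.Fin.Subset.Properties using (_∈?_; _⊆?_)
open import Data.Bool using (true; false)
import Data.Bool as Bool
open import Data.Vec using (Vec; []; _∷_; tabulate)
open import Data.Vec.Properties using (≡-dec)
open import Data.List using (List; []; _∷_; map; _++_; filter; length)
open import Data.Product using (Σ; _×_; ∃; ∃-syntax)
open import Relation.Binary.PropositionalEquality using (_≡_)
open import Relation.Nullary using (Dec; yes; no; does; _×-dec_)
open import Function.Definitions using (Injective)

allSubsets : (n : ℕ) → List (Subset n)
allSubsets zero    = [] ∷ []
allSubsets (suc n) = map (outside ∷_) (allSubsets n) ++ map (inside ∷_) (allSubsets n)

-- An orientation of the complete r-uniform hypergraph H(n,r) on vertex set Fin n:
-- for every edge E (an r-subset of Fin n) a linear ordering of its vertices,
-- given as the bijection  order E : Fin r → E  (position j ↦ vertex at position j).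
-- Values of 'order' on non-edges (|E| ≠ r) are irrelevant.
record Orientation (n r : ℕ) : Set where
  field
    order      : Subset n → Fin r → Fin n
    order-inj  : ∀ E → ∣ E ∣ ≡ r → Injective _≡_ _≡_ (order E)
    order-into : ∀ E → ∣ E ∣ ≡ r → ∀ j → order E j ∈ E
    order-onto : ∀ E → ∣ E ∣ ≡ r → ∀ x → x ∈ E → ∃[ j ] order E j ≡ x
open Orientation public

positions : ∀ {n r} → Orientation n r → Subset n → Subset n → Subset r
positions D S E = tabulate (λ j → Bool.if does (order D E j ∈? S) then inside else outside)

IsCounted : ∀ {n r} → Orientation n r → Subset n → Subset r → Subset n → Set
IsCounted {n} {r} D S P E = (∣ E ∣ ≡ r) × (S ⊆ E) × (positions D S E ≡ P)

isCounted? : ∀ {n r} (D : Orientation n r) (S : Subset n) (P : Subset r) (E : Subset n) →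
             Dec (IsCounted D S P E)
isCounted? {n} {r} D S P E = (∣ E ∣ ≟ r) ×-dec ((S ⊆? E) ×-dec ≡-dec Bool._≟_ (positions D S E) P)

deg : ∀ {n r} → Orientation n r → Subset n → Subset r → ℕ
deg {n} D S P = length (filter (isCounted? D S P) (allSubsets n))

-- Fix a position pattern P, a p-subset of {1, …, r}, and colour each p-set S of vertices by
-- whether d_P(S) ≥ k. No set X of m = (k+1)r + r vertices has all its p-subsets of small
-- degree: each of the C(m,r) edges inside X is counted by the p-set sitting at its positions P,
-- and C(m,r) > (k-1)·C(m,p). So every homogeneous m-set has the high-degree colour, and applying
-- the hypergraph Ramsey theorem once for each of the C(r,p) patterns shrinks a large enough vertex
-- set to a t-set all of whose p-subsets have high degree for every pattern.

module Submission where

open import Defs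
open import Data.Nat using (ℕ; _≤_; _<_)
open import Data.Fin.Subset using (Subset; _⊆_; ∣_∣)
open import Data.Product using (_×_; ∃; ∃-syntax)
open import Relation.Binary.PropositionalEquality using (_≡_)

open import Data.Nat using (zero; suc; _+_; _*_; pred; z≤n; s≤s; _≤ᵇ_)
open import Data.Nat.Properties
open import Data.Nat.Combinatorics using (_C_; nC1≡n; nCk+nC[k+1]≡[n+1]C[k+1])
open import Data.Nat.ListAction using (sum)
open import Data.Nat.Tactic.RingSolver using (solve-∀)
open import Data.Fin using (Fin) renaming (zero to fzero; suc to fsuc)
import Data.Fin.Properties as Fin
open import Data.Fin.Subset using (inside; outside; ⊥; ⊤; ⁅_⁆; _∪_; _∈_; _∉_; _-_; Nonempty)
open import Data.Fin.Subset.Properties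
open import Data.Vec using ([]; _∷_; here; there; lookup)
open import Data.Vec.Properties using (tabulate-cong; tabulate∘lookup; lookup⇒[]=; []=⇒lookup; ≡-dec)
open import Data.Bool using (Bool; true; false)
import Data.Bool as Bool
open import Data.Bool.Properties using (T-≡)
open import Data.List using (List; []; _∷_; map; _++_; filter; length)
open import Data.List.Properties using (filter-++; length-++; filter-≐; filter-none; map-cong)
open import Data.List.Relation.Unary.Any using (here; there; any?)
import Data.List.Relation.Unary.All as All
open import Data.List.Membership.Propositional using (find; lose) renaming (_∈_ to _∈ₗ_)
open import Data.List.Membership.Propositional.Properties using (∈-filter⁺; ∈-filter⁻; ∈-map⁺; ∈-++⁺ˡ; ∈-++⁺ʳ)
open import Data.Product using (_,_; proj₁; proj₂)
open import Data.Sum using (_⊎_; inj₁; inj₂)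
open import Data.Empty using (⊥-elim)
open import Function using (_∘_; Injective)
open import Function.Bundles using (Equivalence)
open import Relation.Binary.PropositionalEquality using (refl; sym; trans; cong; cong₂; subst; module ≡-Reasoning)
open import Relation.Binary using (DecidableEquality)
open import Relation.Nullary using (¬_; yes; no; does; _×-dec_)
open import Relation.Unary using (Decidable; _≐_)

∃⊆-ofSize : ∀ {n} (U : Subset n) a → a ≤ ∣ U ∣ → ∃[ X ] (X ⊆ U × ∣ X ∣ ≡ a)
∃⊆-ofSize [] zero _ = [] , (λ x∈ → x∈) , refl
∃⊆-ofSize (outside ∷ U) a a≤ with X , X⊆U , ∣X∣ ← ∃⊆-ofSize U a a≤ = outside ∷ X , out⊆ X⊆U , ∣X∣
∃⊆-ofSize {suc n} (inside ∷ U) zero _ = ⊥ , ⊥⊆ , ∣⊥∣≡0 (suc n)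
∃⊆-ofSize (inside ∷ U) (suc a) (s≤s a≤) with X , X⊆U , ∣X∣ ← ∃⊆-ofSize U a a≤ =
  inside ∷ X , in⊆in X⊆U , cong suc ∣X∣

∣p∣≡0⇒p≡⊥ : ∀ {n} (p : Subset n) → ∣ p ∣ ≡ 0 → p ≡ ⊥
∣p∣≡0⇒p≡⊥ [] _ = refl
∣p∣≡0⇒p≡⊥ (outside ∷ p) ∣p∣≡0 = cong (outside ∷_) (∣p∣≡0⇒p≡⊥ p ∣p∣≡0)

p⊆⊥⇒∣p∣≡0 : ∀ {n} {p : Subset n} → p ⊆ ⊥ → ∣ p ∣ ≡ 0
p⊆⊥⇒∣p∣≡0 {n} {p} p⊆⊥ = n≤0⇒n≡0 (subst (∣ p ∣ ≤_) (∣⊥∣≡0 n) (p⊆q⇒∣p∣≤∣q∣ p⊆⊥))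

∣p∣>0⇒Nonempty : ∀ {n} (p : Subset n) → 0 < ∣ p ∣ → Nonempty p
∣p∣>0⇒Nonempty (inside ∷ p) _ = fzero , here
∣p∣>0⇒Nonempty (outside ∷ p) ∣p∣>0 with x , x∈p ← ∣p∣>0⇒Nonempty p ∣p∣>0 = fsuc x , there x∈p

x∈p∪⁅y⁆⁻ : ∀ {n} {x y : Fin n} (p : Subset n) → x ∈ p ∪ ⁅ y ⁆ → x ∈ p ⊎ x ≡ y
x∈p∪⁅y⁆⁻ {y = y} p x∈ with x∈p∪q⁻ p ⁅ y ⁆ x∈
... | inj₁ x∈p = inj₁ x∈p
... | inj₂ x∈⁅y⁆ = inj₂ (x∈⁅y⁆⇒x≡y y x∈⁅y⁆)

x∉p⇒∣p∪⁅x⁆∣≡1+∣p∣ : ∀ {n} (x : Fin n) (p : Subset n) → x ∉ p → ∣ p ∪ ⁅ x ⁆ ∣ ≡ suc ∣ p ∣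
x∉p⇒∣p∪⁅x⁆∣≡1+∣p∣ fzero (inside ∷ p) x∉p = ⊥-elim (x∉p here)
x∉p⇒∣p∪⁅x⁆∣≡1+∣p∣ fzero (outside ∷ p) _ = cong (suc ∘ ∣_∣) (∪-identityʳ p)
x∉p⇒∣p∪⁅x⁆∣≡1+∣p∣ (fsuc x) (inside ∷ p) x∉p = cong suc (x∉p⇒∣p∪⁅x⁆∣≡1+∣p∣ x p (x∉p ∘ there))
x∉p⇒∣p∪⁅x⁆∣≡1+∣p∣ (fsuc x) (outside ∷ p) x∉p = x∉p⇒∣p∪⁅x⁆∣≡1+∣p∣ x p (x∉p ∘ there)

x∉p-x : ∀ {n} (x : Fin n) (p : Subset n) → x ∉ p - x
x∉p-x fzero (inside ∷ p) ()
x∉p-x fzero (outside ∷ p) ()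
x∉p-x (fsuc x) (_ ∷ p) (there x∈) = x∉p-x x p x∈

x∈p⇒1+∣p-x∣≡∣p∣ : ∀ {n} {x : Fin n} {p : Subset n} → x ∈ p → suc ∣ p - x ∣ ≡ ∣ p ∣
x∈p⇒1+∣p-x∣≡∣p∣ {p = inside ∷ p} here = cong (suc ∘ ∣_∣) (p─⊥≡p p)
x∈p⇒1+∣p-x∣≡∣p∣ {p = inside ∷ p} (there x∈p) = cong suc (x∈p⇒1+∣p-x∣≡∣p∣ x∈p)
x∈p⇒1+∣p-x∣≡∣p∣ {p = outside ∷ p} (there x∈p) = x∈p⇒1+∣p-x∣≡∣p∣ x∈p

x∈p⇒p-x∪⁅x⁆≡p : ∀ {n} {x : Fin n} {p : Subset n} → x ∈ p → (p - x) ∪ ⁅ x ⁆ ≡ p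
x∈p⇒p-x∪⁅x⁆≡p {p = inside ∷ p} here = cong (inside ∷_) (trans (∪-identityʳ _) (p─⊥≡p p))
x∈p⇒p-x∪⁅x⁆≡p {p = inside ∷ p} (there x∈p) = cong (inside ∷_) (x∈p⇒p-x∪⁅x⁆≡p x∈p)
x∈p⇒p-x∪⁅x⁆≡p {p = outside ∷ p} (there x∈p) = cong (outside ∷_) (x∈p⇒p-x∪⁅x⁆≡p x∈p)

-- Hypergraph Ramsey theorem

Monochromatic : ∀ {n} → (Subset n → Bool) → ℕ → Bool → Subset n → Set
Monochromatic c p β X = ∀ S → S ⊆ X → ∣ S ∣ ≡ p → c S ≡ β

⊥-monochromatic : ∀ {n} (c : Subset n → Bool) p β → Monochromatic c (suc p) β ⊥
⊥-monochromatic c p β S S⊆⊥ ∣S∣≡1+p = ⊥-elim (0≢1+n (trans (sym (p⊆⊥⇒∣p∣≡0 S⊆⊥)) ∣S∣≡1+p))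

ramseyNumber : ℕ → ℕ → ℕ → ℕ
ramseyNumber zero a b = a + b
ramseyNumber (suc p) zero b = 0
ramseyNumber (suc p) (suc a) zero = 0
ramseyNumber (suc p) (suc a) (suc b) =
  suc (ramseyNumber p (ramseyNumber (suc p) a (suc b)) (ramseyNumber (suc p) (suc a) b))

HomogeneousIn : ∀ {n} → ℕ → ℕ → ℕ → (Subset n → Bool) → Subset n → Set
HomogeneousIn p a b c U = ∃[ X ] (X ⊆ U ×
  ((∣ X ∣ ≡ a × Monochromatic c p true X) ⊎ (∣ X ∣ ≡ b × Monochromatic c p false X)))

Ramsey : ℕ → ℕ → ℕ → Set
Ramsey p a b = ∀ {n} (U : Subset n) → ramseyNumber p a b ≤ ∣ U ∣ → (c : Subset n → Bool) →
  HomogeneousIn p a b c U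

monochromatic-∪⁅⁆ : ∀ {n} {c : Subset n → Bool} {p β} {x : Fin n} {X Y : Subset n} → X ⊆ Y →
  Monochromatic (λ T → c (T ∪ ⁅ x ⁆)) p β Y → Monochromatic c (suc p) β X →
  Monochromatic c (suc p) β (X ∪ ⁅ x ⁆)
monochromatic-∪⁅⁆ {c = c} {β = β} {x} {X} {Y} X⊆Y linkY monoX S S⊆ ∣S∣ with x ∈? S
... | yes x∈S = subst (λ T → c T ≡ β) (x∈p⇒p-x∪⁅x⁆≡p x∈S)
                  (linkY (S - x) S-x⊆Y (suc-injective (trans (x∈p⇒1+∣p-x∣≡∣p∣ x∈S) ∣S∣)))
  where
  S-x⊆Y : S - x ⊆ Y
  S-x⊆Y y∈ with x∈p∪⁅y⁆⁻ X (S⊆ (p─q⊆p S ⁅ x ⁆ y∈))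
  ... | inj₁ y∈X = X⊆Y y∈X
  ... | inj₂ refl = ⊥-elim (x∉p-x x S y∈)
... | no x∉S = monoX S S⊆X ∣S∣
  where
  S⊆X : S ⊆ X
  S⊆X y∈ with x∈p∪⁅y⁆⁻ X (S⊆ y∈)
  ... | inj₁ y∈X = y∈X
  ... | inj₂ refl = ⊥-elim (x∉S y∈)

ramsey-zero : ∀ a b → Ramsey zero a b
ramsey-zero a b U size c with c ⊥ in c⊥
... | true with X , X⊆U , ∣X∣ ← ∃⊆-ofSize U a (≤-trans (m≤m+n a b) size) =
  X , X⊆U , inj₁ (∣X∣ , λ S _ ∣S∣ → trans (cong c (∣p∣≡0⇒p≡⊥ S ∣S∣)) c⊥)
... | false with X , X⊆U , ∣X∣ ← ∃⊆-ofSize U b (≤-trans (m≤n+m b a) size) =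
  X , X⊆U , inj₂ (∣X∣ , λ S _ ∣S∣ → trans (cong c (∣p∣≡0⇒p≡⊥ S ∣S∣)) c⊥)

-- Erdős–Rado: remove a vertex v, colour the p-sets of the rest by the colour of their union
-- with v, and apply the two smaller instances inside a homogeneous set of the link colouring.
ramsey-step : ∀ p a b → (∀ a b → Ramsey p a b) → Ramsey (suc p) a (suc b) → Ramsey (suc p) (suc a) b →
  Ramsey (suc p) (suc a) (suc b)
ramsey-step p a b ramsey-p ramsey-a ramsey-b U size c = split (∣p∣>0⇒Nonempty U (≤-trans (s≤s z≤n) size))
  where
  A = ramseyNumber (suc p) a (suc b)
  B = ramseyNumber (suc p) (suc a) b

  shrink : ∀ {v X Y} → Y ⊆ U - v → X ⊆ Y → X ⊆ U
  shrink {v} Y⊆ X⊆Y = p─q⊆p U ⁅ v ⁆ ∘ Y⊆ ∘ X⊆Y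

  grow : ∀ {v β X Y} → v ∈ U → Y ⊆ U - v → X ⊆ Y →
    Monochromatic (λ T → c (T ∪ ⁅ v ⁆)) p β Y → Monochromatic c (suc p) β X →
    X ∪ ⁅ v ⁆ ⊆ U × ∣ X ∪ ⁅ v ⁆ ∣ ≡ suc ∣ X ∣ × Monochromatic c (suc p) β (X ∪ ⁅ v ⁆)
  grow {v} {X = X} {Y} v∈U Y⊆ X⊆Y linkY monoX =
    X∪v⊆U , x∉p⇒∣p∪⁅x⁆∣≡1+∣p∣ v X v∉X , monochromatic-∪⁅⁆ X⊆Y linkY monoX
    where
    v∉X : v ∉ X
    v∉X = x∉p-x v U ∘ Y⊆ ∘ X⊆Y
    X∪v⊆U : X ∪ ⁅ v ⁆ ⊆ U
    X∪v⊆U y∈ with x∈p∪⁅y⁆⁻ X y∈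
    ... | inj₁ y∈X = shrink Y⊆ X⊆Y y∈X
    ... | inj₂ refl = v∈U

  split : Nonempty U → HomogeneousIn (suc p) (suc a) (suc b) c U
  split (v , v∈U) with ramsey-p A B (U - v) (≤-pred (subst (_ ≤_) (sym (x∈p⇒1+∣p-x∣≡∣p∣ v∈U)) size))
                                (λ T → c (T ∪ ⁅ v ⁆))
  ... | Y , Y⊆ , inj₁ (∣Y∣ , linkY) with ramsey-a Y (≤-reflexive (sym ∣Y∣)) c
  ...   | X , X⊆Y , inj₂ w = X , shrink Y⊆ X⊆Y , inj₂ w
  ...   | X , X⊆Y , inj₁ (∣X∣ , monoX) with grow v∈U Y⊆ X⊆Y linkY monoX
  ...     | ⊆U , size∪ , mono∪ = X ∪ ⁅ v ⁆ , ⊆U , inj₁ (trans size∪ (cong suc ∣X∣) , mono∪)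
  split (v , v∈U) | Y , Y⊆ , inj₂ (∣Y∣ , linkY) with ramsey-b Y (≤-reflexive (sym ∣Y∣)) c
  ...   | X , X⊆Y , inj₁ w = X , shrink Y⊆ X⊆Y , inj₁ w
  ...   | X , X⊆Y , inj₂ (∣X∣ , monoX) with grow v∈U Y⊆ X⊆Y linkY monoX
  ...     | ⊆U , size∪ , mono∪ = X ∪ ⁅ v ⁆ , ⊆U , inj₂ (trans size∪ (cong suc ∣X∣) , mono∪)

ramsey : ∀ p a b → Ramsey p a b
ramsey zero = ramsey-zero
ramsey (suc p) zero b {n} U _ c = ⊥ , ⊥⊆ , inj₁ (∣⊥∣≡0 n , ⊥-monochromatic c p true)
ramsey (suc p) (suc a) zero {n} U _ c = ⊥ , ⊥⊆ , inj₂ (∣⊥∣≡0 n , ⊥-monochromatic c p false)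
ramsey (suc p) (suc a) (suc b) =
  ramsey-step p a b (ramsey p) (ramsey (suc p) a (suc b)) (ramsey (suc p) (suc a) b)

-- Binomial coefficients

[1+k]*nC[1+k]+k*nCk≡n*nCk : ∀ n k → suc k * (n C suc k) + k * (n C k) ≡ n * (n C k)
[1+k]*nC[1+k]+k*nCk≡n*nCk zero zero = refl
[1+k]*nC[1+k]+k*nCk≡n*nCk zero (suc k) = cong₂ _+_ (*-zeroʳ (suc (suc k))) (*-zeroʳ (suc k))
[1+k]*nC[1+k]+k*nCk≡n*nCk (suc n) zero = begin
  1 * (suc n C 1) + 0 ≡⟨ +-identityʳ _ ⟩
  1 * (suc n C 1)     ≡⟨ *-identityˡ _ ⟩
  suc n C 1           ≡⟨ nC1≡n (suc n) ⟩
  suc n               ≡⟨ *-identityʳ (suc n) ⟨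
  suc n * 1           ∎
  where open ≡-Reasoning
[1+k]*nC[1+k]+k*nCk≡n*nCk (suc n) (suc k) = begin
  suc (suc k) * (suc n C suc (suc k)) + suc k * (suc n C suc k)
    ≡⟨ cong₂ (λ x y → suc (suc k) * x + suc k * y)
             (nCk+nC[k+1]≡[n+1]C[k+1] n (suc k)) (nCk+nC[k+1]≡[n+1]C[k+1] n k) ⟨
  suc (suc k) * (b + c) + suc k * (a + b)
    ≡⟨ regroup k a b c ⟩
  (suc (suc k) * c + suc k * b) + (suc k * b + k * a) + (a + b)
    ≡⟨ cong₂ (λ x y → x + y + (a + b)) ([1+k]*nC[1+k]+k*nCk≡n*nCk n (suc k)) ([1+k]*nC[1+k]+k*nCk≡n*nCk n k) ⟩
  n * b + n * a + (a + b)
    ≡⟨ collect n a b ⟩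
  suc n * (a + b)
    ≡⟨ cong (suc n *_) (nCk+nC[k+1]≡[n+1]C[k+1] n k) ⟩
  suc n * (suc n C suc k) ∎
  where
  open ≡-Reasoning
  a = n C k
  b = n C suc k
  c = n C suc (suc k)
  regroup : ∀ k a b c → suc (suc k) * (b + c) + suc k * (a + b) ≡
                        (suc (suc k) * c + suc k * b) + (suc k * b + k * a) + (a + b)
  regroup = solve-∀
  collect : ∀ n a b → n * b + n * a + (a + b) ≡ suc n * (a + b)
  collect = solve-∀

nCk-growth : ∀ {n k} c → suc c * suc k + k ≤ n → suc c * (n C k) ≤ n C suc k
nCk-growth {n} {k} c size = *-cancelˡ-≤ (suc k) (+-cancelʳ-≤ (k * (n C k)) _ _ (begin
  suc k * (suc c * (n C k)) + k * (n C k) ≡⟨ cong (_+ k * (n C k)) (*-assoc (suc k) (suc c) (n C k)) ⟨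
  suc k * suc c * (n C k) + k * (n C k)   ≡⟨ *-distribʳ-+ (n C k) (suc k * suc c) k ⟨
  (suc k * suc c + k) * (n C k)           ≤⟨ *-monoˡ-≤ (n C k) (subst (λ z → z + k ≤ n) (*-comm (suc c) _) size) ⟩
  n * (n C k)                             ≡⟨ [1+k]*nC[1+k]+k*nCk≡n*nCk n k ⟨
  suc k * (n C suc k) + k * (n C k)       ∎))
  where open ≤-Reasoning

nCi≤nCj : ∀ {n i j} → i ≤ j → j + j ≤ n → n C i ≤ n C j
nCi≤nCj {j = zero} z≤n _ = ≤-refl
nCi≤nCj {n} {i} {suc j} i≤1+j 2j≤n with m≤n⇒m<n∨m≡n i≤1+j
... | inj₂ refl = ≤-refl
... | inj₁ (s≤s i≤j) = begin
  n C i       ≤⟨ nCi≤nCj i≤j (≤-trans (+-mono-≤ (n≤1+n j) (n≤1+n j)) 2j≤n) ⟩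
  n C j       ≡⟨ *-identityˡ (n C j) ⟨
  1 * (n C j) ≤⟨ nCk-growth 0 (subst (_≤ n) (cong (_+ j) (sym (*-identityˡ (suc j))))
                                 (≤-trans (+-monoʳ-≤ (suc j) (n≤1+n j)) 2j≤n)) ⟩
  n C suc j   ∎
  where open ≤-Reasoning

0<nCk : ∀ {n k} → k ≤ n → 0 < n C k
0<nCk {k = zero} _ = s≤s z≤n
0<nCk {suc n} {suc k} (s≤s k≤n) =
  subst (0 <_) (nCk+nC[k+1]≡[n+1]C[k+1] n k) (≤-trans (0<nCk k≤n) (m≤m+n _ _))

binomial-gap : ∀ {m p r} c → p < r → suc c * r + r ≤ m → c * (m C p) < m C r
binomial-gap {m} {p} {r} c p<r size = begin-strict
  c * (m C p)      <⟨ +-monoˡ-< (c * (m C p)) (0<nCk (≤-trans (<⇒≤ p<r) (≤-trans (m≤n+m r _) size))) ⟩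
  suc c * (m C p)  ≤⟨ nCk-growth c (≤-trans (+-mono-≤ (*-monoʳ-≤ (suc c) p<r) (<⇒≤ p<r)) size) ⟩
  m C suc p        ≤⟨ nCi≤nCj p<r (≤-trans (+-monoˡ-≤ r (m≤m+n r (c * r))) size) ⟩
  m C r            ∎
  where open ≤-Reasoning

-- Vertices at given positions of an edge

image : ∀ {r n} → (Fin r → Fin n) → Subset r → Subset n
image {zero} f [] = ⊥
image {suc r} f (outside ∷ A) = image (f ∘ fsuc) A
image {suc r} f (inside ∷ A) = image (f ∘ fsuc) A ∪ ⁅ f fzero ⁆

∈-image⁻ : ∀ {r n} (f : Fin r → Fin n) A {x} → x ∈ image f A → ∃[ j ] (j ∈ A × f j ≡ x)
∈-image⁻ {zero} f [] x∈ = ⊥-elim (∉⊥ x∈)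
∈-image⁻ {suc r} f (outside ∷ A) x∈ with j , j∈A , fj≡x ← ∈-image⁻ (f ∘ fsuc) A x∈ = fsuc j , there j∈A , fj≡x
∈-image⁻ {suc r} f (inside ∷ A) x∈ with x∈p∪⁅y⁆⁻ (image (f ∘ fsuc) A) x∈
... | inj₂ x≡f0 = fzero , here , sym x≡f0
... | inj₁ x∈′ with j , j∈A , fj≡x ← ∈-image⁻ (f ∘ fsuc) A x∈′ = fsuc j , there j∈A , fj≡x

∈-image⁺ : ∀ {r n} (f : Fin r → Fin n) A {j} → j ∈ A → f j ∈ image f A
∈-image⁺ f (inside ∷ A) here = x∈p∪q⁺ (inj₂ (x∈⁅x⁆ (f fzero)))
∈-image⁺ f (outside ∷ A) (there j∈A) = ∈-image⁺ (f ∘ fsuc) A j∈A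
∈-image⁺ f (inside ∷ A) (there j∈A) = x∈p∪q⁺ (inj₁ (∈-image⁺ (f ∘ fsuc) A j∈A))

∣image∣≡∣A∣ : ∀ {r n} (f : Fin r → Fin n) → Injective _≡_ _≡_ f → ∀ A → ∣ image f A ∣ ≡ ∣ A ∣
∣image∣≡∣A∣ {zero} {n} f _ [] = ∣⊥∣≡0 n
∣image∣≡∣A∣ {suc r} f f-inj (outside ∷ A) = ∣image∣≡∣A∣ (f ∘ fsuc) (Fin.suc-injective ∘ f-inj) A
∣image∣≡∣A∣ {suc r} f f-inj (inside ∷ A) =
  trans (x∉p⇒∣p∪⁅x⁆∣≡1+∣p∣ (f fzero) _ f0∉) (cong suc (∣image∣≡∣A∣ (f ∘ fsuc) (Fin.suc-injective ∘ f-inj) A))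
  where
  f0∉ : f fzero ∉ image (f ∘ fsuc) A
  f0∉ f0∈ with _ , _ , fj≡f0 ← ∈-image⁻ (f ∘ fsuc) A f0∈ with () ← f-inj fj≡f0

verticesAt : ∀ {n r} → Orientation n r → Subset n → Subset r → Subset n
verticesAt D E = image (order D E)

module _ {n r} (D : Orientation n r) {E : Subset n} (edge : ∣ E ∣ ≡ r) (P : Subset r) where

  ∣verticesAt∣ : ∣ verticesAt D E P ∣ ≡ ∣ P ∣
  ∣verticesAt∣ = ∣image∣≡∣A∣ (order D E) (order-inj D E edge) P

  verticesAt-counted : IsCounted D (verticesAt D E P) P E
  verticesAt-counted = edge , verticesAt⊆E , trans (tabulate-cong position) (tabulate∘lookup P)
    where
    verticesAt⊆E : verticesAt D E P ⊆ E
    verticesAt⊆E x∈ with j , _ , refl ← ∈-image⁻ (order D E) P x∈ = order-into D E edge j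

    position : ∀ j → (Bool.if does (order D E j ∈? verticesAt D E P) then inside else outside) ≡ lookup P j
    position j with order D E j ∈? verticesAt D E P | lookup P j in Pj
    ... | yes _ | true = refl
    ... | no _ | false = refl
    ... | no ∉ | true = ⊥-elim (∉ (∈-image⁺ (order D E) P (lookup⇒[]= j P Pj)))
    ... | yes ∈ | false with i , i∈P , oi≡oj ← ∈-image⁻ (order D E) P ∈
                       with refl ← order-inj D E edge oi≡oj
                       with () ← trans (sym ([]=⇒lookup i∈P)) Pj

-- Counting

length-filter-map : ∀ {A B : Set} {P : B → Set} (P? : Decidable P) (f : A → B) xs →
  length (filter P? (map f xs)) ≡ length (filter (P? ∘ f) xs)
length-filter-map P? f [] = refl
length-filter-map P? f (x ∷ xs) with does (P? (f x))
... | true = cong suc (length-filter-map P? f xs)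
... | false = length-filter-map P? f xs

length-filter-filter≤ : ∀ {A : Set} {P Q R : A → Set} (P? : Decidable P) (Q? : Decidable Q) (R? : Decidable R) →
  (∀ {x} → Q x → P x → R x) → ∀ xs → length (filter P? (filter Q? xs)) ≤ length (filter R? xs)
length-filter-filter≤ P? Q? R? Q⇒P⇒R [] = z≤n
length-filter-filter≤ P? Q? R? Q⇒P⇒R (x ∷ xs) with Q? x | R? x
... | no _ | no _ = length-filter-filter≤ P? Q? R? Q⇒P⇒R xs
... | no _ | yes _ = m≤n⇒m≤1+n (length-filter-filter≤ P? Q? R? Q⇒P⇒R xs)
... | yes q | yes _ with P? x
...   | yes _ = s≤s (length-filter-filter≤ P? Q? R? Q⇒P⇒R xs)
...   | no _ = m≤n⇒m≤1+n (length-filter-filter≤ P? Q? R? Q⇒P⇒R xs)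
length-filter-filter≤ P? Q? R? Q⇒P⇒R (x ∷ xs) | yes q | no ¬r with P? x
...   | yes p = ⊥-elim (¬r (Q⇒P⇒R q p))
...   | no _ = length-filter-filter≤ P? Q? R? Q⇒P⇒R xs

sum-map-+ : ∀ {B : Set} (f h : B → ℕ) ys → sum (map (λ y → f y + h y) ys) ≡ sum (map f ys) + sum (map h ys)
sum-map-+ f h [] = refl
sum-map-+ f h (y ∷ ys) = trans (cong (f y + h y +_) (sum-map-+ f h ys)) (+-+-comm (f y) (h y) _ _)
  where
  +-+-comm : ∀ a b c d → (a + b) + (c + d) ≡ (a + c) + (b + d)
  +-+-comm = solve-∀

sum-map-≤ : ∀ {B : Set} (f : B → ℕ) K ys → (∀ {y} → y ∈ₗ ys → f y ≤ K) → sum (map f ys) ≤ length ys * K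
sum-map-≤ f K [] _ = z≤n
sum-map-≤ f K (y ∷ ys) f≤K = +-mono-≤ (f≤K (here refl)) (sum-map-≤ f K ys (f≤K ∘ there))

module _ {A B : Set} (_≟ᴮ_ : DecidableEquality B) (g : A → B) where

  fibreSize : List A → B → ℕ
  fibreSize xs y = length (filter (λ x → g x ≟ᴮ y) xs)

  fibreSize-++ : ∀ xs zs y → fibreSize (xs ++ zs) y ≡ fibreSize xs y + fibreSize zs y
  fibreSize-++ xs zs y = trans (cong length (filter-++ (λ x → g x ≟ᴮ y) xs zs)) (length-++ (filter _ xs))

  1≤Σfibres[x] : ∀ {x} ys → g x ∈ₗ ys → 1 ≤ sum (map (fibreSize (x ∷ [])) ys)
  1≤Σfibres[x] {x} (_ ∷ ys) (here refl) with g x ≟ᴮ g x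
  ... | yes _ = s≤s z≤n
  ... | no gx≢gx = ⊥-elim (gx≢gx refl)
  1≤Σfibres[x] (_ ∷ ys) (there gx∈) = ≤-trans (1≤Σfibres[x] ys gx∈) (m≤n+m _ _)

  length≤Σfibres : ∀ ys xs → (∀ {x} → x ∈ₗ xs → g x ∈ₗ ys) → length xs ≤ sum (map (fibreSize xs) ys)
  length≤Σfibres ys [] _ = z≤n
  length≤Σfibres ys (x ∷ xs) g∈ = begin
    suc (length xs)
      ≤⟨ +-mono-≤ (1≤Σfibres[x] ys (g∈ (here refl))) (length≤Σfibres ys xs (g∈ ∘ there)) ⟩
    sum (map (fibreSize (x ∷ [])) ys) + sum (map (fibreSize xs) ys)
      ≡⟨ sum-map-+ _ _ ys ⟨
    sum (map (λ y → fibreSize (x ∷ []) y + fibreSize xs y) ys)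
      ≡⟨ cong sum (map-cong (fibreSize-++ (x ∷ []) xs) ys) ⟨
    sum (map (fibreSize (x ∷ xs)) ys) ∎
    where open ≤-Reasoning

  pigeonhole : ∀ ys xs K → (∀ {x} → x ∈ₗ xs → g x ∈ₗ ys) → (∀ {y} → y ∈ₗ ys → fibreSize xs y ≤ K) →
    length xs ≤ length ys * K
  pigeonhole ys xs K g∈ fibre≤ = ≤-trans (length≤Σfibres ys xs g∈) (sum-map-≤ (fibreSize xs) K ys fibre≤)

∈-allSubsets : ∀ {n} (S : Subset n) → S ∈ₗ allSubsets n
∈-allSubsets [] = here refl
∈-allSubsets {suc n} (outside ∷ S) = ∈-++⁺ˡ (∈-map⁺ (outside ∷_) (∈-allSubsets S))
∈-allSubsets {suc n} (inside ∷ S) = ∈-++⁺ʳ (map (outside ∷_) (allSubsets n)) (∈-map⁺ (inside ∷_) (∈-allSubsets S))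

length-filter-allSubsets : ∀ {n} {P : Subset (suc n) → Set} (P? : Decidable P) →
  length (filter P? (allSubsets (suc n))) ≡
  length (filter (P? ∘ (outside ∷_)) (allSubsets n)) + length (filter (P? ∘ (inside ∷_)) (allSubsets n))
length-filter-allSubsets {n} P? = begin
  length (filter P? (map (outside ∷_) L ++ map (inside ∷_) L))
    ≡⟨ cong length (filter-++ P? (map (outside ∷_) L) _) ⟩
  length (filter P? (map (outside ∷_) L) ++ filter P? (map (inside ∷_) L))
    ≡⟨ length-++ (filter P? (map (outside ∷_) L)) ⟩
  length (filter P? (map (outside ∷_) L)) + length (filter P? (map (inside ∷_) L))
    ≡⟨ cong₂ _+_ (length-filter-map P? (outside ∷_) L) (length-filter-map P? (inside ∷_) L) ⟩
  length (filter (P? ∘ (outside ∷_)) L) + length (filter (P? ∘ (inside ∷_)) L) ∎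
  where
  open ≡-Reasoning
  L = allSubsets n

OfSize : ∀ {n} → ℕ → Subset n → Subset n → Set
OfSize j X E = ∣ E ∣ ≡ j × E ⊆ X

ofSize? : ∀ {n} j (X : Subset n) → Decidable (OfSize j X)
ofSize? j X E = (∣ E ∣ ≟ j) ×-dec (E ⊆? X)

subsetsOfSize : ∀ {n} → ℕ → Subset n → List (Subset n)
subsetsOfSize {n} j X = filter (ofSize? j X) (allSubsets n)

length-subsetsOfSize-∷ : ∀ {n} j s (X : Subset n) →
  length (subsetsOfSize j (s ∷ X)) ≡
  length (subsetsOfSize j X) + length (filter (ofSize? j (s ∷ X) ∘ (inside ∷_)) (allSubsets n))
length-subsetsOfSize-∷ {n} j s X = trans (length-filter-allSubsets (ofSize? j (s ∷ X)))
  (cong (_+ length (filter (ofSize? j (s ∷ X) ∘ (inside ∷_)) (allSubsets n)))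
        (cong length (filter-≐ _ (ofSize? j X) without-0 (allSubsets n))))
  where
  without-0 : (OfSize j (s ∷ X) ∘ (outside ∷_)) ≐ OfSize j X
  without-0 = (λ (∣E∣ , E⊆) → ∣E∣ , drop-∷-⊆ E⊆) , (λ (∣E∣ , E⊆) → ∣E∣ , out⊆ E⊆)

length-subsetsOfSize : ∀ {n} j (X : Subset n) → length (subsetsOfSize j X) ≡ ∣ X ∣ C j
length-subsetsOfSize zero [] = refl
length-subsetsOfSize (suc j) [] = refl
length-subsetsOfSize {suc n} j (outside ∷ X) = begin
  length (subsetsOfSize j (outside ∷ X))
    ≡⟨ trans (length-subsetsOfSize-∷ j outside X)
             (cong₂ _+_ (length-subsetsOfSize j X) (none λ (_ , E⊆) → 0∉ (E⊆ here))) ⟩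
  ∣ X ∣ C j + 0                          ≡⟨ +-identityʳ _ ⟩
  ∣ X ∣ C j                              ∎
  where
  open ≡-Reasoning
  none : (∀ {E} → ¬ OfSize j (outside ∷ X) (inside ∷ E)) →
         length (filter (ofSize? j (outside ∷ X) ∘ (inside ∷_)) (allSubsets n)) ≡ 0
  none ¬ofSize = cong length (filter-none _ (All.universal (λ _ → ¬ofSize) (allSubsets n)))
  0∉ : fzero ∉ outside ∷ X
  0∉ ()
length-subsetsOfSize {suc n} zero (inside ∷ X) = begin
  length (subsetsOfSize zero (inside ∷ X))
    ≡⟨ trans (length-subsetsOfSize-∷ zero inside X) (cong₂ _+_ (length-subsetsOfSize zero X) none) ⟩
  ∣ X ∣ C 0 + 0 ∎
  where
  open ≡-Reasoning
  none : length (filter (ofSize? zero (inside ∷ X) ∘ (inside ∷_)) (allSubsets n)) ≡ 0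
  none = cong length (filter-none _ (All.universal (λ _ (∣E∣ , _) → 1+n≢0 ∣E∣) (allSubsets n)))
length-subsetsOfSize {suc n} (suc j) (inside ∷ X) = begin
  length (subsetsOfSize (suc j) (inside ∷ X))
    ≡⟨ length-subsetsOfSize-∷ (suc j) inside X ⟩
  length (subsetsOfSize (suc j) X) + length (filter (ofSize? (suc j) (inside ∷ X) ∘ (inside ∷_)) (allSubsets n))
    ≡⟨ cong (length (subsetsOfSize (suc j) X) +_) (cong length (filter-≐ _ (ofSize? j X) with-0 (allSubsets n))) ⟩
  length (subsetsOfSize (suc j) X) + length (subsetsOfSize j X)
    ≡⟨ cong₂ _+_ (length-subsetsOfSize (suc j) X) (length-subsetsOfSize j X) ⟩
  ∣ X ∣ C suc j + ∣ X ∣ C j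
    ≡⟨ +-comm (∣ X ∣ C suc j) _ ⟩
  ∣ X ∣ C j + ∣ X ∣ C suc j
    ≡⟨ nCk+nC[k+1]≡[n+1]C[k+1] ∣ X ∣ j ⟩
  suc ∣ X ∣ C suc j ∎
  where
  open ≡-Reasoning
  with-0 : (OfSize (suc j) (inside ∷ X) ∘ (inside ∷_)) ≐ OfSize j X
  with-0 = (λ (∣E∣ , E⊆) → suc-injective ∣E∣ , drop-∷-⊆ E⊆) , (λ (∣E∣ , E⊆) → cong suc ∣E∣ , in⊆in E⊆)

module _ {n r} (D : Orientation n r) {p} (p<r : p < r) {P : Subset r} (∣P∣≡p : ∣ P ∣ ≡ p) where

  ∃-highDegree : ∀ k {X : Subset n} → ∣ X ∣ ≡ suc k * r + r →
    ∃[ S ] (S ⊆ X × ∣ S ∣ ≡ p × k ≤ deg D S P)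
  ∃-highDegree k {X} ∣X∣ with any? (λ S → k ≤? deg D S P) (subsetsOfSize p X)
  ... | yes some with S , S∈ , k≤deg ← find some
                 with ∣S∣ , S⊆X ← proj₂ (∈-filter⁻ (ofSize? p X) {xs = allSubsets n} S∈) =
    S , S⊆X , ∣S∣ , k≤deg
  ... | no none = ⊥-elim (<⇒≱ (binomial-gap (pred k) p<r size) counting)
    where
    m = suc k * r + r
    edges = subsetsOfSize r X
    atP = λ E → verticesAt D E P

    size : suc (pred k) * r + r ≤ m
    size = +-monoˡ-≤ r (*-monoˡ-≤ r (s≤s (pred[n]≤n {k})))

    pattern∈ : ∀ {E} → E ∈ₗ edges → atP E ∈ₗ subsetsOfSize p X
    pattern∈ E∈ with _ , edge , E⊆X ← ∈-filter⁻ (ofSize? r X) {xs = allSubsets n} E∈ =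
      ∈-filter⁺ (ofSize? p X) (∈-allSubsets _)
        (trans (∣verticesAt∣ D edge P) ∣P∣≡p , E⊆X ∘ proj₁ (proj₂ (verticesAt-counted D edge P)))

    fibre≤ : ∀ {S} → S ∈ₗ subsetsOfSize p X → fibreSize (≡-dec Bool._≟_) atP edges S ≤ pred k
    fibre≤ {S} S∈ = ≤-trans
      (length-filter-filter≤ _ (ofSize? r X) (isCounted? D S P) counts (allSubsets n))
      (suc[m]≤n⇒m≤pred[n] (≰⇒> (none ∘ lose S∈)))
      where
      counts : ∀ {E} → OfSize r X E → atP E ≡ S → IsCounted D S P E
      counts (edge , _) refl = verticesAt-counted D edge P

    counting : m C r ≤ pred k * (m C p)
    counting = begin
      m C r                                  ≡⟨ trans (length-subsetsOfSize r X) (cong (_C r) ∣X∣) ⟨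
      length edges                           ≤⟨ pigeonhole (≡-dec Bool._≟_) atP _ edges (pred k) pattern∈ fibre≤ ⟩
      length (subsetsOfSize p X) * pred k    ≡⟨ cong (_* pred k) (trans (length-subsetsOfSize p X) (cong (_C p) ∣X∣)) ⟩
      (m C p) * pred k                       ≡⟨ *-comm (m C p) (pred k) ⟩
      pred k * (m C p)                       ∎
      where open ≤-Reasoning

-- Ramsey's theorem for finitely many colourings simultaneously

iteratedRamseyNumber : ℕ → ℕ → ℕ → ℕ → ℕ
iteratedRamseyNumber p t m zero = t
iteratedRamseyNumber p t m (suc l) = ramseyNumber p (iteratedRamseyNumber p t m l) m

ramsey-simultaneous : ∀ {I : Set} {n} p t m (colour : I → Subset n → Bool) is (U : Subset n) →
  (∀ {i} → i ∈ₗ is → ∀ X → ∣ X ∣ ≡ m → ¬ Monochromatic (colour i) p false X) →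
  iteratedRamseyNumber p t m (length is) ≤ ∣ U ∣ →
  ∃[ B ] (B ⊆ U × ∣ B ∣ ≡ t × (∀ {i} → i ∈ₗ is → Monochromatic (colour i) p true B))
ramsey-simultaneous p t m colour [] U _ size with B , B⊆U , ∣B∣ ← ∃⊆-ofSize U t size = B , B⊆U , ∣B∣ , λ ()
ramsey-simultaneous p t m colour (i ∷ is) U no-false size with ramsey p _ m U size (colour i)
... | X , _ , inj₂ (∣X∣ , monoX) = ⊥-elim (no-false (here refl) X ∣X∣ monoX)
... | X , X⊆U , inj₁ (∣X∣ , monoX)
  with B , B⊆X , ∣B∣ , monoB ← ramsey-simultaneous p t m colour is X (no-false ∘ there) (≤-reflexive (sym ∣X∣)) =
  B , X⊆U ∘ B⊆X , ∣B∣ , λ { (here refl) S S⊆B → monoX S (B⊆X ∘ S⊆B) ; (there i∈) → monoB i∈ }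

theorem13 : (r p t k : ℕ) → p < r → 1 ≤ p → p ≤ t → 1 ≤ k →
    ∃[ N ] (0 < N × (∀ n → N ≤ n → (D : Orientation n r) →
      ∃[ B ] (∣ B ∣ ≡ t × (∀ (S : Subset n) → S ⊆ B → ∣ S ∣ ≡ p →
        ∀ (P : Subset r) → ∣ P ∣ ≡ p → k ≤ deg D S P))))
theorem13 r p t k p<r _ _ _ = suc N , s≤s z≤n , highDegreeSet
  where
  m = suc k * r + r
  patterns = subsetsOfSize p (⊤ {r})
  N = iteratedRamseyNumber p t m (length patterns)

  colour : ∀ {n} → Orientation n r → Subset r → Subset n → Bool
  colour D P S = k ≤ᵇ deg D S P

  no-low-set : ∀ {n} (D : Orientation n r) {P} → P ∈ₗ patterns → ∀ X → ∣ X ∣ ≡ m →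
    ¬ Monochromatic (colour D P) p false X
  no-low-set D {P} P∈ X ∣X∣ low
    with ∣P∣ , _ ← proj₂ (∈-filter⁻ (ofSize? p ⊤) {xs = allSubsets r} P∈)
    with S , S⊆X , ∣S∣ , k≤deg ← ∃-highDegree D p<r ∣P∣ k ∣X∣
    with () ← trans (sym (low S S⊆X ∣S∣)) (Equivalence.to T-≡ (≤⇒≤ᵇ k≤deg))

  highDegreeSet : ∀ n → suc N ≤ n → (D : Orientation n r) →
    ∃[ B ] (∣ B ∣ ≡ t × (∀ (S : Subset n) → S ⊆ B → ∣ S ∣ ≡ p →
      ∀ (P : Subset r) → ∣ P ∣ ≡ p → k ≤ deg D S P))
  highDegreeSet n N<n D
    with B , _ , ∣B∣ , monoB ← ramsey-simultaneous p t m (colour D) patterns ⊤ (no-low-set D)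
                                  (subst (N ≤_) (sym (∣⊤∣≡n n)) (≤-trans (n≤1+n N) N<n)) =
    B , ∣B∣ , λ S S⊆B ∣S∣ P ∣P∣ →
      let P∈ = ∈-filter⁺ (ofSize? p ⊤) (∈-allSubsets P) (∣P∣ , ⊆-max P)
      in ≤ᵇ⇒≤ k _ (Equivalence.from T-≡ (monoB P∈ S S⊆B ∣S∣))
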